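{- Let $\mathcal C$ be a binary linear $[n,k]$ code with generator matrix of standard form $C=(I_k\mid P)$, $P$ a $k\times(n-k)$ binary matrix whose rows are labelled $1,\ldots,k$ and whose columns are labelled $k+1,\ldots,n$. Let $G$ be the graph on vertex set $\{1,\ldots,n\}$ with adjacency matrix $\begin{pmatrix}0_{k\times k}&P\\P^{T}&0_{(n-k)\times(n-k)}\end{pmatrix}$. Let $u\le k<v$ with $uv$ an edge of $G$ (i.e. $P_{u,v}=1$), and let $G'$ be the graph obtained from $G$ by pivoting on the edge $uv$ followed by swapping the vertices $u$ and $v$. Then $G'$ has adjacency matrix $\begin{pmatrix}0_{k\times k}&P'\\P'^{T}&0\end{pmatrix}$ for a $k\times(n-k)$ matrix $P'$, and $P'$ is obtained from $P$ by: (1) storing the current column $v$; (2) adding row $u$ to every row $a\neq u$ with $P_{a,v}=1$; (3) resetting column $v$ to the stored value.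
   Context: $\mathcal N(a)$ denotes the neighbourhood of a vertex $a$. Pivoting on an edge $ij$ of a graph: partition $V\setminus\{i,j\}$ into $\mathcal N(i)\setminus\mathcal N(j)$, $\mathcal N(j)\setminus\mathcal N(i)$, $\mathcal N(i)\cap\mathcal N(j)$, and the vertices adjacent to neither; for every pair $\{x,y\}$ with $x,y$ in two different ones of the first three sets, toggle the pair (delete edge $xy$ if present, add it otherwise); finally swap the labels of $i$ and $j$. "Swapping the vertices $u$ and $v$" means relabelling by the transposition $(u\,v)$. All matrix arithmetic is over $\mathrm{GF}(2)$. -}

module Defs where

open import Data.Nat using (ℕ; _+_)
open import Data.Fin using (Fin; splitAt; _↑ˡ_; _↑ʳ_; _≟_)
open import Data.Bool using (Bool; true; false; if_then_else_; not; _∧_; _xor_)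
open import Data.Sum using (_⊎_; inj₁; inj₂)
open import Relation.Nullary.Decidable using (⌊_⌋)

Adj : ℕ → Set
Adj n = Fin n → Fin n → Bool

Mat : ℕ → ℕ → Set
Mat k m = Fin k → Fin m → Bool

swapFin : ∀ {n} → Fin n → Fin n → Fin n → Fin n
swapFin i j x = if ⌊ x ≟ i ⌋ then j else (if ⌊ x ≟ j ⌋ then i else x)

swapVertices : ∀ {n} → Adj n → Fin n → Fin n → Adj n
swapVertices A i j x y = A (swapFin i j x) (swapFin i j y)

-- The class of a vertex x ∉ {i,j} w.r.t. the pivot on ij.
data Cls : Set where
  onlyI onlyJ both neither : Cls

cls : Bool → Bool → Cls
cls true  false = onlyI
cls false true  = onlyJ
cls true  true  = both
cls false false = neither

differentClasses : Cls → Cls → Bool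
differentClasses onlyI onlyJ = true
differentClasses onlyI both  = true
differentClasses onlyJ onlyI = true
differentClasses onlyJ both  = true
differentClasses both  onlyI = true
differentClasses both  onlyJ = true
differentClasses _     _     = false

outside : ∀ {n} → Fin n → Fin n → Fin n → Bool
outside i j x = not ⌊ x ≟ i ⌋ ∧ not ⌊ x ≟ j ⌋

pivotToggle : ∀ {n} → Adj n → Fin n → Fin n → Adj n
pivotToggle A i j x y =
  if outside i j x ∧ outside i j y
       ∧ differentClasses (cls (A i x) (A j x)) (cls (A i y) (A j y))
  then not (A x y) else A x y

pivot : ∀ {n} → Adj n → Fin n → Fin n → Adj n
pivot A i j = swapVertices (pivotToggle A i j) i j

-- Bipartite adjacency matrix ( 0 P ; Pᵀ 0 ) on vertex set Fin (k + m):
-- the first k vertices are rows of P, the last m are columns of P.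
blockAdj : ∀ {k m} → Mat k m → Adj (k + m)
blockAdj {k} P x y with splitAt k x | splitAt k y
... | inj₁ a | inj₂ c = P a c
... | inj₂ c | inj₁ a = P a c
... | _      | _      = false

storedColumn : ∀ {k m} → Mat k m → Fin m → Fin k → Bool
storedColumn P v a = P a v

addRowStep : ∀ {k m} → Mat k m → Fin k → Fin m → Mat k m
addRowStep P u v a c =
  if not ⌊ a ≟ u ⌋ ∧ P a v then P a c xor P u c else P a c

resetColumn : ∀ {k m} → Mat k m → Fin m → (Fin k → Bool) → Mat k m
resetColumn Q v col a c = if ⌊ c ≟ v ⌋ then col a else Q a c

updateP : ∀ {k m} → Mat k m → Fin k → Fin m → Mat k m
updateP P u v = resetColumn (addRowStep P u v) v (storedColumn P v)

module Submission where

-- Relative to the pivot edge uv, a row vertex a ≠ u of the bipartite graph is in N(v) ∖ N(u)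
-- iff P a v, a column vertex c ≠ v is in N(u) ∖ N(v) iff P u c, and N(u) ∩ N(v) is empty.
-- Hence the pivot toggles exactly the pairs {a, c} with a ≠ u, c ≠ v and P a v = P u c = 1,
-- which is adding row u to each row a with P a v = 1 away from column v, and it creates no
-- edge inside either side. The final swap of u and v undoes the relabelling done by the pivot.

open import Defs
open import Data.Nat using (ℕ; _+_)
open import Data.Fin using (Fin; _↑ˡ_; _↑ʳ_; _≟_; splitAt; join)
open import Data.Fin.Properties using (splitAt-↑ˡ; splitAt-↑ʳ; ↑ˡ-injective; ↑ʳ-injective; join-splitAt)
open import Data.Bool using (Bool; true; false; if_then_else_; not; _∧_; _xor_)
open import Data.Bool.Properties using (∧-zeroʳ)
open import Data.Sum using (inj₁; inj₂)
open import Data.Product using (Σ; _×_; _,_)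
open import Function using (_∘_)
open import Function.Definitions using (Injective)
open import Relation.Nullary using (yes; no; ¬_)
open import Relation.Nullary.Decidable using (Dec; ⌊_⌋; isYes≗does; dec-true; dec-false)
open import Relation.Binary.PropositionalEquality
  using (_≡_; _≢_; refl; sym; trans; cong; cong₂; subst₂)

⌊⌋-true : ∀ {p} {A : Set p} (a? : Dec A) → A → ⌊ a? ⌋ ≡ true
⌊⌋-true a? a = trans (isYes≗does a?) (dec-true a? a)

⌊⌋-false : ∀ {p} {A : Set p} (a? : Dec A) → ¬ A → ⌊ a? ⌋ ≡ false
⌊⌋-false a? ¬a = trans (isYes≗does a?) (dec-false a? ¬a)

swapFin-involutive : ∀ {n} (i j x : Fin n) → swapFin i j (swapFin i j x) ≡ x
swapFin-involutive i j x with x ≟ i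
... | yes refl with j ≟ i
...   | yes refl = refl
...   | no j≢i rewrite ⌊⌋-true (j ≟ j) refl = refl
swapFin-involutive i j x | no x≢i with x ≟ j
... | yes refl rewrite ⌊⌋-true (i ≟ i) refl = refl
... | no x≢j rewrite ⌊⌋-false (x ≟ i) x≢i | ⌊⌋-false (x ≟ j) x≢j = refl

swapVertices-involutive : ∀ {n} (A : Adj n) (i j x y : Fin n) →
  swapVertices (swapVertices A i j) i j x y ≡ A x y
swapVertices-involutive A i j x y =
  cong₂ A (swapFin-involutive i j x) (swapFin-involutive i j y)

≟-injective : ∀ {m n} {f : Fin m → Fin n} → Injective _≡_ _≡_ f →
  ∀ a b → ⌊ f a ≟ f b ⌋ ≡ ⌊ a ≟ b ⌋
≟-injective {f = f} f-inj a b with a ≟ b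
... | yes refl = ⌊⌋-true (f a ≟ f a) refl
... | no a≢b = ⌊⌋-false (f a ≟ f b) (a≢b ∘ f-inj)

if-∧-not≡if-xor : ∀ p q r → (if p ∧ q then not r else r) ≡ (if p then r xor q else r)
if-∧-not≡if-xor false q     r     = refl
if-∧-not≡if-xor true  false false = refl
if-∧-not≡if-xor true  false true  = refl
if-∧-not≡if-xor true  true  false = refl
if-∧-not≡if-xor true  true  true  = refl

toggles : ∀ {n} → Adj n → Fin n → Fin n → Fin n → Fin n → Bool
toggles A i j x y =
  outside i j x ∧ outside i j y
    ∧ differentClasses (cls (A i x) (A j x)) (cls (A i y) (A j y))

differentClasses-onlyJ-neither : ∀ p q → differentClasses (cls false p) (cls false q) ≡ false
differentClasses-onlyJ-neither false false = refl
differentClasses-onlyJ-neither false true  = refl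
differentClasses-onlyJ-neither true  false = refl
differentClasses-onlyJ-neither true  true  = refl

differentClasses-onlyI-neither : ∀ p q → differentClasses (cls p false) (cls q false) ≡ false
differentClasses-onlyI-neither false false = refl
differentClasses-onlyI-neither false true  = refl
differentClasses-onlyI-neither true  false = refl
differentClasses-onlyI-neither true  true  = refl

differentClasses-onlyJ-onlyI : ∀ p q → differentClasses (cls false p) (cls q false) ≡ p ∧ q
differentClasses-onlyJ-onlyI false false = refl
differentClasses-onlyJ-onlyI false true  = refl
differentClasses-onlyJ-onlyI true  false = refl
differentClasses-onlyJ-onlyI true  true  = refl

differentClasses-onlyI-onlyJ : ∀ p q → differentClasses (cls q false) (cls false p) ≡ p ∧ q
differentClasses-onlyI-onlyJ false false = refl
differentClasses-onlyI-onlyJ false true  = refl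
differentClasses-onlyI-onlyJ true  false = refl
differentClasses-onlyI-onlyJ true  true  = refl

module _ {k m : ℕ} where

  ↑ˡ≢↑ʳ : (a : Fin k) (c : Fin m) → a ↑ˡ m ≢ k ↑ʳ c
  ↑ˡ≢↑ʳ a c eq
    with () ← trans (sym (splitAt-↑ˡ k a m)) (trans (cong (splitAt k) eq) (splitAt-↑ʳ k m c))

  ⌊↑ˡ≟↑ʳ⌋ : (a : Fin k) (c : Fin m) → ⌊ a ↑ˡ m ≟ k ↑ʳ c ⌋ ≡ false
  ⌊↑ˡ≟↑ʳ⌋ a c = ⌊⌋-false (a ↑ˡ m ≟ k ↑ʳ c) (↑ˡ≢↑ʳ a c)

  ⌊↑ʳ≟↑ˡ⌋ : (c : Fin m) (a : Fin k) → ⌊ k ↑ʳ c ≟ a ↑ˡ m ⌋ ≡ false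
  ⌊↑ʳ≟↑ˡ⌋ c a = ⌊⌋-false (k ↑ʳ c ≟ a ↑ˡ m) (↑ˡ≢↑ʳ a c ∘ sym)

  ⌊↑ˡ≟↑ˡ⌋ : (a b : Fin k) → ⌊ a ↑ˡ m ≟ b ↑ˡ m ⌋ ≡ ⌊ a ≟ b ⌋
  ⌊↑ˡ≟↑ˡ⌋ = ≟-injective (↑ˡ-injective m _ _)

  ⌊↑ʳ≟↑ʳ⌋ : (c d : Fin m) → ⌊ k ↑ʳ c ≟ k ↑ʳ d ⌋ ≡ ⌊ c ≟ d ⌋
  ⌊↑ʳ≟↑ʳ⌋ = ≟-injective (↑ʳ-injective k _ _)

  blockAdj-ext : {A B : Adj (k + m)} →
    (∀ s t → A (join k m s) (join k m t) ≡ B (join k m s) (join k m t)) →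
    ∀ x y → A x y ≡ B x y
  blockAdj-ext {A} {B} agree x y =
    subst₂ (λ x y → A x y ≡ B x y) (join-splitAt k m x) (join-splitAt k m y)
      (agree (splitAt k x) (splitAt k y))

  blockAdj-rows : (P : Mat k m) (a b : Fin k) → blockAdj P (a ↑ˡ m) (b ↑ˡ m) ≡ false
  blockAdj-rows P a b rewrite splitAt-↑ˡ k a m | splitAt-↑ˡ k b m = refl

  blockAdj-row-col : (P : Mat k m) (a : Fin k) (c : Fin m) → blockAdj P (a ↑ˡ m) (k ↑ʳ c) ≡ P a c
  blockAdj-row-col P a c rewrite splitAt-↑ˡ k a m | splitAt-↑ʳ k m c = refl

  blockAdj-col-row : (P : Mat k m) (c : Fin m) (a : Fin k) → blockAdj P (k ↑ʳ c) (a ↑ˡ m) ≡ P a c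
  blockAdj-col-row P c a rewrite splitAt-↑ˡ k a m | splitAt-↑ʳ k m c = refl

  blockAdj-cols : (P : Mat k m) (c d : Fin m) → blockAdj P (k ↑ʳ c) (k ↑ʳ d) ≡ false
  blockAdj-cols P c d rewrite splitAt-↑ʳ k m c | splitAt-↑ʳ k m d = refl

  module _ (P : Mat k m) (u : Fin k) (v : Fin m) where

    toggles-rows : (a b : Fin k) → toggles (blockAdj P) (u ↑ˡ m) (k ↑ʳ v) (a ↑ˡ m) (b ↑ˡ m) ≡ false
    toggles-rows a b
      rewrite blockAdj-rows P u a | blockAdj-rows P u b | blockAdj-col-row P v a | blockAdj-col-row P v b
            | differentClasses-onlyJ-neither (P a v) (P b v)
            | ∧-zeroʳ (outside (u ↑ˡ m) (k ↑ʳ v) (b ↑ˡ m)) | ∧-zeroʳ (outside (u ↑ˡ m) (k ↑ʳ v) (a ↑ˡ m))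
      = refl

    toggles-cols : (c d : Fin m) → toggles (blockAdj P) (u ↑ˡ m) (k ↑ʳ v) (k ↑ʳ c) (k ↑ʳ d) ≡ false
    toggles-cols c d
      rewrite blockAdj-row-col P u c | blockAdj-row-col P u d | blockAdj-cols P v c | blockAdj-cols P v d
            | differentClasses-onlyI-neither (P u c) (P u d)
            | ∧-zeroʳ (outside (u ↑ˡ m) (k ↑ʳ v) (k ↑ʳ d)) | ∧-zeroʳ (outside (u ↑ˡ m) (k ↑ʳ v) (k ↑ʳ c))
      = refl

    toggles-row-col : (a : Fin k) (c : Fin m) →
      toggles (blockAdj P) (u ↑ˡ m) (k ↑ʳ v) (a ↑ˡ m) (k ↑ʳ c)
        ≡ (not ⌊ a ≟ u ⌋ ∧ not ⌊ c ≟ v ⌋) ∧ P a v ∧ P u c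
    toggles-row-col a c
      rewrite blockAdj-rows P u a | blockAdj-col-row P v a | blockAdj-row-col P u c | blockAdj-cols P v c
            | ⌊↑ˡ≟↑ˡ⌋ a u | ⌊↑ˡ≟↑ʳ⌋ a v | ⌊↑ʳ≟↑ˡ⌋ c u | ⌊↑ʳ≟↑ʳ⌋ c v
            | differentClasses-onlyJ-onlyI (P a v) (P u c)
      with a ≟ u | c ≟ v
    ... | yes _ | _     = refl
    ... | no _  | yes _ = refl
    ... | no _  | no _  = refl

    toggles-col-row : (c : Fin m) (a : Fin k) →
      toggles (blockAdj P) (u ↑ˡ m) (k ↑ʳ v) (k ↑ʳ c) (a ↑ˡ m)
        ≡ (not ⌊ a ≟ u ⌋ ∧ not ⌊ c ≟ v ⌋) ∧ P a v ∧ P u c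
    toggles-col-row c a
      rewrite blockAdj-rows P u a | blockAdj-col-row P v a | blockAdj-row-col P u c | blockAdj-cols P v c
            | ⌊↑ˡ≟↑ˡ⌋ a u | ⌊↑ˡ≟↑ʳ⌋ a v | ⌊↑ʳ≟↑ˡ⌋ c u | ⌊↑ʳ≟↑ʳ⌋ c v
            | differentClasses-onlyI-onlyJ (P a v) (P u c)
      with a ≟ u | c ≟ v
    ... | yes _ | yes _ = refl
    ... | yes _ | no _  = refl
    ... | no _  | yes _ = refl
    ... | no _  | no _  = refl

    updateP-as-toggle : (a : Fin k) (c : Fin m) →
      (if (not ⌊ a ≟ u ⌋ ∧ not ⌊ c ≟ v ⌋) ∧ P a v ∧ P u c then not (P a c) else P a c)
        ≡ updateP P u v a c
    updateP-as-toggle a c with a ≟ u | c ≟ v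
    ... | yes refl | yes refl = refl
    ... | yes refl | no _     = refl
    ... | no _     | yes refl = refl
    ... | no _     | no _     = if-∧-not≡if-xor (P a v) (P u c) (P a c)

    pivotToggle-blockAdj : ∀ x y →
      pivotToggle (blockAdj P) (u ↑ˡ m) (k ↑ʳ v) x y ≡ blockAdj (updateP P u v) x y
    pivotToggle-blockAdj = blockAdj-ext onBlocks
      where
      toggleIf : Bool → Bool → Bool
      toggleIf t r = if t then not r else r

      onBlocks : ∀ s t →
        pivotToggle (blockAdj P) (u ↑ˡ m) (k ↑ʳ v) (join k m s) (join k m t)
          ≡ blockAdj (updateP P u v) (join k m s) (join k m t)
      onBlocks (inj₁ a) (inj₁ b) =
        trans (cong₂ toggleIf (toggles-rows a b) (blockAdj-rows P a b))
              (sym (blockAdj-rows (updateP P u v) a b))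
      onBlocks (inj₂ c) (inj₂ d) =
        trans (cong₂ toggleIf (toggles-cols c d) (blockAdj-cols P c d))
              (sym (blockAdj-cols (updateP P u v) c d))
      onBlocks (inj₁ a) (inj₂ c) =
        trans (cong₂ toggleIf (toggles-row-col a c) (blockAdj-row-col P a c))
              (trans (updateP-as-toggle a c) (sym (blockAdj-row-col (updateP P u v) a c)))
      onBlocks (inj₂ c) (inj₁ a) =
        trans (cong₂ toggleIf (toggles-col-row c a) (blockAdj-col-row P c a))
              (trans (updateP-as-toggle a c) (sym (blockAdj-col-row (updateP P u v) c a)))

-- The identity holds whether or not uv is an edge, so the hypothesis P u v ≡ true is unused.
lemma8 : (k m : ℕ) (P : Mat k m) (u : Fin k) (v : Fin m) →
    P u v ≡ true →
    Σ (Mat k m) (λ P′ →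
      ((x y : Fin (k + m)) →
        swapVertices (pivot (blockAdj P) (u ↑ˡ m) (k ↑ʳ v)) (u ↑ˡ m) (k ↑ʳ v) x y
          ≡ blockAdj P′ x y)
      × ((a : Fin k) (c : Fin m) → P′ a c ≡ updateP P u v a c))
lemma8 k m P u v _ = updateP P u v , adjacency , λ _ _ → refl
  where
  adjacency : (x y : Fin (k + m)) →
    swapVertices (pivot (blockAdj P) (u ↑ˡ m) (k ↑ʳ v)) (u ↑ˡ m) (k ↑ʳ v) x y
      ≡ blockAdj (updateP P u v) x y
  adjacency x y =
    trans (swapVertices-involutive (pivotToggle (blockAdj P) (u ↑ˡ m) (k ↑ʳ v)) (u ↑ˡ m) (k ↑ʳ v) x y)
          (pivotToggle-blockAdj P u v x y)
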